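{- Let $T$ be a transmission irregular tree of order $n \ge 2$, and let $v \in V(T)$ be a vertex having the minimum transmission in $T$. Then $d_T(v) \ge 3$, and every connected component of $T - v$ has fewer than $\frac{n}{2}$ vertices.
   Context: For a connected graph $G$ and $u,v \in V(G)$, $d_G(u,v)$ is the length of a shortest $(u,v)$-path. The transmission of $v \in V(G)$ is $\mathrm{Tr}_G(v) = \sum_{u \in V(G)} d_G(v,u)$. A connected graph $G$ is transmission irregular (TI) if any two distinct vertices of $G$ have different transmissions. $d_T(v)$ denotes the degree of $v$ in $T$, and $T - v$ is the graph obtained by deleting $v$. -}

module Defs where

open import Data.Nat using (ℕ; zero; suc; _+_; _≤_)
open import Data.Bool using (Bool; true; false; if_then_else_; T)
open import Data.Fin using (Fin; punchIn)
open import Data.Fin.Subset using (Subset; _∈_)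
open import Data.List using (List; []; _∷_; length; map; allFin)
open import Data.Nat.ListAction using (sum)
open import Data.Unit using (⊤)
open import Data.List.Relation.Unary.Unique.Propositional using (Unique)
open import Data.Product using (Σ; ∃; _×_; _,_)
open import Relation.Binary.PropositionalEquality using (_≡_; _≢_)
open import Relation.Nullary using (¬_)

record Graph (n : ℕ) : Set where
  field
    adj   : Fin n → Fin n → Bool
    sym   : ∀ u v → adj u v ≡ adj v u
    irrefl : ∀ v → adj v v ≡ false
open Graph public

Edge : ∀ {n} → Graph n → Fin n → Fin n → Set
Edge G u v = T (adj G u v)

data Walk {n : ℕ} (G : Graph n) : Fin n → Fin n → ℕ → Set where
  here : ∀ {v} → Walk G v v zero
  step : ∀ {u w v k} → Edge G u w → Walk G w v k → Walk G u v (suc k)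

Connected : ∀ {n} → Graph n → Set
Connected G = ∀ u v → ∃ λ k → Walk G u v k

ConsecAdj : ∀ {n} → Graph n → List (Fin n) → Set
ConsecAdj G [] = ⊤
ConsecAdj G (x ∷ []) = ⊤
ConsecAdj G (x ∷ y ∷ xs) = Edge G x y × ConsecAdj G (y ∷ xs)

IsCycle : ∀ {n} → Graph n → Fin n → List (Fin n) → Set
IsCycle G x xs =
  3 ≤ suc (length xs) × Unique (x ∷ xs) × ConsecAdj G (x ∷ xs)
  × LastAdj xs
  where
    LastAdj : List (Fin _) → Set
    LastAdj [] = Edge G x x
    LastAdj (y ∷ []) = Edge G y x
    LastAdj (y ∷ z ∷ ys) = LastAdj (z ∷ ys)

Acyclic : ∀ {n} → Graph n → Set
Acyclic G = ∀ x xs → ¬ IsCycle G x xs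

IsTree : ∀ {n} → Graph n → Set
IsTree G = Connected G × Acyclic G

IsDistance : ∀ {n} → Graph n → Fin n → Fin n → ℕ → Set
IsDistance G u v k = Walk G u v k × (∀ m → Walk G u v m → k ≤ m)

Tr : ∀ {n} → (Fin n → Fin n → ℕ) → Fin n → ℕ
Tr {n} d v = sum (map (d v) (allFin n))

TransmissionIrregular : ∀ {n} → (Fin n → Fin n → ℕ) → Set
TransmissionIrregular d = ∀ u v → u ≢ v → Tr d u ≢ Tr d v

degree : ∀ {n} → Graph n → Fin n → ℕ
degree {n} G v = sum (map (λ u → if adj G v u then 1 else 0) (allFin n))

deleteVertex : ∀ {m} → Graph (suc m) → Fin (suc m) → Graph m
deleteVertex G v = record
  { adj = λ i j → adj G (punchIn v i) (punchIn v j)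
  ; sym = λ i j → sym G (punchIn v i) (punchIn v j)
  ; irrefl = λ i → irrefl G (punchIn v i) }

-- A connected component: a nonempty vertex set, internally connected (by walks of the graph),
-- and closed under adjacency (hence maximal).
IsComponent : ∀ {n} → Graph n → Subset n → Set
IsComponent G C =
  (∃ λ x → x ∈ C)
  × (∀ x y → x ∈ C → y ∈ C → ∃ λ k → Walk G x y k)
  × (∀ x y → x ∈ C → Edge G x y → y ∈ C)

{-# OPTIONS --safe #-}
module Submission where

-- For a neighbour y of v let B(y), written nearer y v, be the set of vertices strictly closer
-- to y than to v. Moving from v to y changes every distance by at most one and decreases it on
-- B(y), so Tr(y) + 2|B(y)| ≤ Tr(v) + n. At a vertex v of minimum transmission in a transmission
-- irregular graph Tr(v) < Tr(y), hence 2|B(y)| < n, and Tr(y) = Tr(v) + 1 if 2|B(y)| = n - 1.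
-- Each vertex x ≠ v lies in B(y) for the first vertex y of a geodesic from v to x, so the sets
-- B(y) cover the n - 1 ≥ 1 vertices other than v. One neighbour cannot do this, and two
-- neighbours a, b could only if 2|B(a)| = 2|B(b)| = n - 1, forcing Tr(a) = Tr(b).
-- In a tree, a component C of T - v contains exactly one neighbour u of v (two would close a
-- cycle through v), every geodesic from v into C starts at u, so C ⊆ B(u) and 2|C| < n.

open import Defs hiding (sym)
open import Data.Bool using (Bool; true; false; T; if_then_else_)
open import Data.Empty using (⊥)
open import Data.Fin using (Fin; zero; suc; punchIn; punchOut; fromℕ<) renaming (_≟_ to _≟ᶠ_)
open import Data.Fin.Properties using (punchIn-injective; punchInᵢ≢i; punchIn-punchOut)
open import Data.Fin.Subset using (Subset; ∣_∣; inside; outside) renaming (_∈_ to _∈ₛ_)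
open import Data.List using (List; []; _∷_; map; allFin; tabulate; length; filter)
open import Data.List.Membership.Propositional using (_∈_; _∉_; lose)
open import Data.List.Membership.Propositional.Properties using (∈-filter⁺; ∈-filter⁻; ∈-allFin; ∈-map⁻)
open import Data.List.Properties using (map-tabulate)
open import Data.List.Relation.Unary.All using (All; []; _∷_)
open import Data.List.Relation.Unary.All.Properties using (¬Any⇒All¬)
open import Data.List.Relation.Unary.AllPairs using ([]; _∷_)
open import Data.List.Relation.Unary.Any using (Any; here; there; toSum)
open import Data.List.Relation.Unary.Any.Properties using (singleton⁻)
open import Data.List.Relation.Unary.Unique.Propositional using (Unique)
open import Data.List.Relation.Unary.Unique.Propositional.Properties using (filter⁺; allFin⁺; map⁺)
import Data.List.Relation.Unary.All as All
open import Data.Nat using (ℕ; zero; suc; _+_; _*_; _≤_; _<_; z≤n; s≤s; _<?_)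
open import Data.Nat.ListAction using (sum)
open import Data.Nat.Properties
open import Algebra.Properties.Semiring.Sum +-*-semiring
  using (sum-syntax; sum-remove; ∑-distrib-+; *-distribˡ-sum)
open import Data.Product using (∃; ∃-syntax; _×_; _,_; proj₁; proj₂)
open import Data.Sum using (_⊎_; inj₁; inj₂; map₂)
open import Data.Unit using (tt)
open import Data.Vec using ([]; _∷_; here; there)
open import Function using (_∘_)
open import Relation.Binary.PropositionalEquality
open import Relation.Nullary using (yes; no; contradiction)
open import Relation.Nullary.Decidable using (T?; ⌊_⌋; fromWitness)

sum-allFin : ∀ n (f : Fin n → ℕ) → sum (map f (allFin n)) ≡ ∑[ i < n ] f i
sum-allFin n f = trans (cong sum (map-tabulate (λ i → i) f)) (sum-tabulate n)
  where
    sum-tabulate : ∀ n {g : Fin n → ℕ} → sum (tabulate g) ≡ ∑[ i < n ] g i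
    sum-tabulate zero = refl
    sum-tabulate (suc n) {g} = cong (g zero +_) (sum-tabulate n)

∑-mono-≤ : ∀ {n} {f g : Fin n → ℕ} → (∀ i → f i ≤ g i) → ∑[ i < n ] f i ≤ ∑[ i < n ] g i
∑-mono-≤ {zero} f≤g = z≤n
∑-mono-≤ {suc n} f≤g = +-mono-≤ (f≤g zero) (∑-mono-≤ (f≤g ∘ suc))

n≤∑ : ∀ {n} {f : Fin n → ℕ} → (∀ i → 1 ≤ f i) → n ≤ ∑[ i < n ] f i
n≤∑ {zero}  _   = z≤n
n≤∑ {suc n} 1≤f = +-mono-≤ (1≤f zero) (n≤∑ (1≤f ∘ suc))

∑-const : ∀ n c → ∑[ i < n ] c ≡ n * c
∑-const zero c = refl
∑-const (suc n) c = cong (c +_) (∑-const n c)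

indicator : Bool → ℕ
indicator b = if b then 1 else 0

count : ∀ {n} → (Fin n → Bool) → ℕ
count {n} p = ∑[ i < n ] indicator (p i)

sum-indicator≡length-filter : ∀ {A : Set} (p : A → Bool) xs →
                              sum (map (indicator ∘ p) xs) ≡ length (filter (T? ∘ p) xs)
sum-indicator≡length-filter p [] = refl
sum-indicator≡length-filter p (x ∷ xs) with p x
... | true  = cong suc (sum-indicator≡length-filter p xs)
... | false = sum-indicator≡length-filter p xs

count-punchIn-≤ : ∀ {n} (p : Fin (suc n) → Bool) i → count (p ∘ punchIn i) ≤ count p
count-punchIn-≤ p i =
  subst (count (p ∘ punchIn i) ≤_) (sym (sum-remove {i = i} (indicator ∘ p))) (m≤n+m _ _)

T⇒1≤indicator : ∀ {b} → T b → 1 ≤ indicator b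
T⇒1≤indicator {true} _ = ≤-refl

count-all : ∀ {n} {p : Fin n → Bool} → (∀ i → T (p i)) → n ≤ count p
count-all all = n≤∑ (T⇒1≤indicator ∘ all)

count-cover₂ : ∀ {n} {p q : Fin n → Bool} → (∀ i → T (p i) ⊎ T (q i)) → n ≤ count p + count q
count-cover₂ {p = p} {q} cover =
  ≤-trans (n≤∑ (1≤indicator+indicator ∘ cover))
          (≤-reflexive (∑-distrib-+ (indicator ∘ p) (indicator ∘ q)))
  where
    1≤indicator+indicator : ∀ {a b} → T a ⊎ T b → 1 ≤ indicator a + indicator b
    1≤indicator+indicator     (inj₁ t) = ≤-trans (T⇒1≤indicator t) (m≤m+n _ _)
    1≤indicator+indicator {a} (inj₂ t) = ≤-trans (T⇒1≤indicator t) (m≤n+m _ (indicator a))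

∣p∣≤count : ∀ {n} (p : Subset n) {q : Fin n → Bool} → (∀ i → i ∈ₛ p → T (q i)) → ∣ p ∣ ≤ count q
∣p∣≤count [] p⊆q = z≤n
∣p∣≤count (inside ∷ p) {q} p⊆q with q zero | p⊆q zero here
... | true | _ = s≤s (∣p∣≤count p (λ i i∈p → p⊆q (suc i) (there i∈p)))
∣p∣≤count (outside ∷ p) {q} p⊆q =
  ≤-trans (∣p∣≤count p (λ i i∈p → p⊆q (suc i) (there i∈p))) (m≤n+m _ (indicator (q zero)))

n<2*n : ∀ {n} → 1 ≤ n → n < 2 * n
n<2*n {n} 1≤n = m<m+n n (subst (1 ≤_) (sym (*-identityˡ n)) 1≤n)

≤+∧2*≤⇒2*≡ : ∀ {m} x y → m ≤ x + y → 2 * x ≤ m → 2 * y ≤ m → 2 * x ≡ m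
≤+∧2*≤⇒2*≡ {m} x y m≤x+y 2x≤m 2y≤m = ≤-antisym 2x≤m (+-cancelʳ-≤ m m (2 * x) (begin
  m + m              ≡⟨ cong (m +_) (sym (+-identityʳ m)) ⟩
  2 * m              ≤⟨ *-monoʳ-≤ 2 m≤x+y ⟩
  2 * (x + y)        ≡⟨ *-distribˡ-+ 2 x y ⟩
  2 * x + 2 * y      ≤⟨ +-monoʳ-≤ (2 * x) 2y≤m ⟩
  2 * x + m          ∎))
  where open ≤-Reasoning

module _ {n} (G : Graph n) where

  edge-sym : ∀ {a b} → Edge G a b → Edge G b a
  edge-sym {a} {b} = subst T (Graph.sym G a b)

  edge⇒≢ : ∀ {a b} → Edge G a b → a ≢ b
  edge⇒≢ {a} e refl = subst T (irrefl G a) e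

  walk-first-step : ∀ {a b k} → Walk G a b k → a ≢ b →
                    ∃[ y ] ∃[ j ] (Edge G a y × Walk G y b j × j < k)
  walk-first-step here       a≢b = contradiction refl a≢b
  walk-first-step (step e w) _   = _ , _ , e , w , ≤-refl

  neighbours : Fin n → List (Fin n)
  neighbours v = filter (T? ∘ adj G v) (allFin n)

  degree≡length-neighbours : ∀ v → degree G v ≡ length (neighbours v)
  degree≡length-neighbours v = sum-indicator≡length-filter (adj G v) (allFin n)

  ∈-neighbours⁺ : ∀ {v y} → Edge G v y → y ∈ neighbours v
  ∈-neighbours⁺ e = ∈-filter⁺ (T? ∘ adj G _) (∈-allFin _) e

  ∈-neighbours⁻ : ∀ {v y} → y ∈ neighbours v → Edge G v y
  ∈-neighbours⁻ = proj₂ ∘ ∈-filter⁻ (T? ∘ adj G _) {xs = allFin n}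

  neighbours-unique : ∀ v → Unique (neighbours v)
  neighbours-unique v = filter⁺ (T? ∘ adj G v) (allFin⁺ n)

data Path {n} (G : Graph n) : Fin n → Fin n → List (Fin n) → Set where
  stop : ∀ {a} → Path G a a (a ∷ [])
  step : ∀ {a b c xs} → Edge G a b → Path G b c xs → Path G a c (a ∷ xs)

-- IsCycle's condition that the last vertex is adjacent to the first is local to its where
-- block; it is recovered here by unification.
ClosingEdge : ∀ {n} → Graph n → Fin n → List (Fin n) → Set
ClosingEdge G x xs = lastFactor refl
  where
    lastFactor : ∀ {A B C L : Set} → IsCycle G x xs ≡ (A × B × C × L) → Set
    lastFactor {L = L} _ = L

module _ {n} {G : Graph n} where

  open import Data.List.Membership.DecPropositional (_≟ᶠ_ {n}) using (_∈?_)

  path-suffix : ∀ {a b c xs} → Path G b c xs → a ∈ xs → Unique xs →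
                ∃[ ys ] (Path G a c ys × Unique ys)
  path-suffix stop       (here refl)  u       = _ , stop , u
  path-suffix (step e p) (here refl)  u       = _ , step e p , u
  path-suffix (step e p) (there a∈xs) (_ ∷ u) = path-suffix p a∈xs u

  walk⇒path : ∀ {a b k} → Walk G a b k → ∃[ xs ] (Path G a b xs × Unique xs)
  walk⇒path here = _ , stop , [] ∷ []
  walk⇒path {a} (step e w) with walk⇒path w
  ... | xs , p , u with a ∈? xs
  ...   | yes a∈xs = path-suffix p a∈xs u
  ...   | no  a∉xs = a ∷ xs , step e p , ¬Any⇒All¬ xs a∉xs ∷ u

  path-consecAdj : ∀ {x a b xs} → Edge G x a → Path G a b xs → ConsecAdj G (x ∷ xs)
  path-consecAdj e stop       = e , tt
  path-consecAdj e (step f p) = e , path-consecAdj f p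

  path-closingEdge : ∀ {x a b xs} → Path G a b xs → Edge G b x → ClosingEdge G x xs
  path-closingEdge stop                e = e
  path-closingEdge (step _ stop)       e = e
  path-closingEdge (step _ (step f p)) e = path-closingEdge (step f p) e

  path-length : ∀ {a b xs} → Path G a b xs → a ≢ b → 2 ≤ length xs
  path-length stop                a≢b = contradiction refl a≢b
  path-length (step _ stop)       _   = ≤-refl
  path-length (step _ (step _ _)) _   = s≤s (s≤s z≤n)

  path⇒cycle : ∀ {x a b xs} → Path G a b xs → Unique xs → a ≢ b → x ∉ xs →
               Edge G x a → Edge G b x → IsCycle G x xs
  path⇒cycle p u a≢b x∉xs xa bx =
    s≤s (path-length p a≢b) , ¬Any⇒All¬ _ x∉xs ∷ u , path-consecAdj xa p , path-closingEdge p bx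

path-punchIn : ∀ {m} {G : Graph (suc m)} {v a b xs} → Path (deleteVertex G v) a b xs →
               Path G (punchIn v a) (punchIn v b) (map (punchIn v) xs)
path-punchIn stop       = stop
path-punchIn (step e p) = step e (path-punchIn p)

∉-map-punchIn : ∀ {m} (v : Fin (suc m)) xs → v ∉ map (punchIn v) xs
∉-map-punchIn v xs v∈ with ∈-map⁻ (punchIn v) v∈
... | x , _ , v≡ = punchInᵢ≢i v x (sym v≡)

walk-between-neighbours⇒≡ : ∀ {m} {G : Graph (suc m)} → Acyclic G → ∀ v {y₁ y₂ k} →
                            Walk (deleteVertex G v) y₁ y₂ k →
                            Edge G v (punchIn v y₁) → Edge G v (punchIn v y₂) → y₁ ≡ y₂
walk-between-neighbours⇒≡ {G = G} acyclic v {y₁} {y₂} w e₁ e₂ with y₁ ≟ᶠ y₂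
... | yes y₁≡y₂ = y₁≡y₂
... | no  y₁≢y₂ with walk⇒path w
...   | xs , p , u = contradiction cycle (acyclic v (map (punchIn v) xs))
  where
    punchIn-inj : ∀ {x y} → punchIn v x ≡ punchIn v y → x ≡ y
    punchIn-inj = punchIn-injective v _ _

    cycle : IsCycle G v (map (punchIn v) xs)
    cycle = path⇒cycle (path-punchIn p) (map⁺ punchIn-inj u) (y₁≢y₂ ∘ punchIn-inj)
                       (∉-map-punchIn v xs) e₁ (edge-sym G e₂)

module Transmission {n} (G : Graph n) (d : Fin n → Fin n → ℕ)
                    (isDist : ∀ u w → IsDistance G u w (d u w)) where

  geodesic : ∀ a b → Walk G a b (d a b)
  geodesic a b = proj₁ (isDist a b)

  d-minimal : ∀ {a b k} → Walk G a b k → d a b ≤ k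
  d-minimal {a} {b} {k} = proj₂ (isDist a b) k

  d-edge : ∀ {a b} c → Edge G a b → d a c ≤ suc (d b c)
  d-edge c e = d-minimal (step e (geodesic _ c))

  nearer : Fin n → Fin n → Fin n → Bool
  nearer y v x = ⌊ d y x <? d v x ⌋

  walk⇒nearer : ∀ {v y x j} → Walk G y x j → j < d v x → T (nearer y v x)
  walk⇒nearer w j<d = fromWitness (≤-<-trans (d-minimal w) j<d)

  geodesic-step : ∀ {v x} → v ≢ x → ∃[ y ] ∃[ j ] (Edge G v y × Walk G y x j × j < d v x)
  geodesic-step = walk-first-step G (geodesic _ _)

  Tr+2*count-nearer≤ : ∀ {v y} → Edge G v y → Tr d y + 2 * count (nearer y v) ≤ Tr d v + n
  Tr+2*count-nearer≤ {v} {y} e = begin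
    Tr d y + 2 * count (nearer y v)
      ≡⟨ cong₂ _+_ (sum-allFin n (d y)) (*-distribˡ-sum 2 (indicator ∘ nearer y v)) ⟩
    ∑[ x < n ] d y x + ∑[ x < n ] (2 * indicator (nearer y v x))
      ≡⟨ sym (∑-distrib-+ (d y) (λ x → 2 * indicator (nearer y v x))) ⟩
    ∑[ x < n ] (d y x + 2 * indicator (nearer y v x))
      ≤⟨ ∑-mono-≤ pointwise ⟩
    ∑[ x < n ] (d v x + 1)
      ≡⟨ ∑-distrib-+ (d v) (λ _ → 1) ⟩
    ∑[ x < n ] d v x + ∑[ x < n ] 1
      ≡⟨ cong₂ _+_ (sym (sum-allFin n (d v))) (trans (∑-const n 1) (*-identityʳ n)) ⟩
    Tr d v + n ∎
    where
      open ≤-Reasoning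
      pointwise : ∀ x → d y x + 2 * indicator (nearer y v x) ≤ d v x + 1
      pointwise x with d y x <? d v x
      ... | yes y<v = subst (_≤ d v x + 1) (sym (+-suc (d y x) 1)) (+-monoˡ-≤ 1 y<v)
      ... | no  _   = subst₂ _≤_ (sym (+-identityʳ (d y x))) (+-comm 1 (d v x))
                             (d-edge x (edge-sym G e))

module ComponentGeodesics {m} (G : Graph (suc m)) (d : Fin (suc m) → Fin (suc m) → ℕ)
                          (isDist : ∀ u w → IsDistance G u w (d u w)) (v : Fin (suc m))
                          {C : Subset m}
                          (closed : ∀ x y → x ∈ₛ C → Edge (deleteVertex G v) x y → y ∈ₛ C) where

  open Transmission G d isDist

  -- A walk to b that is shorter than d v b cannot pass through v, so it stays in T - v.
  walk-into-component : ∀ {a b k} → Walk G a (punchIn v b) k → k < d v (punchIn v b) →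
                        b ∈ₛ C → ∃[ a′ ] (punchIn v a′ ≡ a × a′ ∈ₛ C)
  walk-into-component here       _   b∈C = _ , refl , b∈C
  walk-into-component {a} (step e w) k<d b∈C
    with walk-into-component w (<-trans (n<1+n _) k<d) b∈C
  ... | c , refl , c∈C = punchOut v≢a , punchIn-punchOut v≢a , closed c _ c∈C e′
    where
      v≢a : v ≢ a
      v≢a refl = <⇒≱ k<d (d-minimal (step e w))

      e′ : Edge G (punchIn v c) (punchIn v (punchOut v≢a))
      e′ = subst (Edge G (punchIn v c)) (sym (punchIn-punchOut v≢a)) (edge-sym G e)

  component-geodesic-step : ∀ {b} → b ∈ₛ C →
                            ∃[ y ] (Edge G v (punchIn v y) × y ∈ₛ C
                                    × T (nearer (punchIn v y) v (punchIn v b)))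
  component-geodesic-step {b} b∈C with geodesic-step (punchInᵢ≢i v b ∘ sym)
  ... | _ , j , e , w , j<d with walk-into-component w j<d b∈C
  ...   | y , refl , y∈C = y , e , y∈C , walk⇒nearer w j<d

  component⊆nearer : Acyclic G →
                     (∀ x y → x ∈ₛ C → y ∈ₛ C → ∃ λ k → Walk (deleteVertex G v) x y k) →
                     ∀ {x₀} → x₀ ∈ₛ C →
                     ∃[ u ] (Edge G v u × ∀ x → x ∈ₛ C → T (nearer u v (punchIn v x)))
  component⊆nearer acyclic connected x₀∈C with component-geodesic-step x₀∈C
  ... | u , e , u∈C , _ = punchIn v u , e , C⊆nearer
    where
      C⊆nearer : ∀ x → x ∈ₛ C → T (nearer (punchIn v u) v (punchIn v x))
      C⊆nearer x x∈C with component-geodesic-step x∈C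
      ... | y , e′ , y∈C , y-nearer
        with walk-between-neighbours⇒≡ acyclic v (proj₂ (connected y u y∈C u∈C)) e′ e
      ...   | refl = y-nearer

module MinimumTransmission {m} (G : Graph (suc m)) (d : Fin (suc m) → Fin (suc m) → ℕ)
                           (isDist : ∀ u w → IsDistance G u w (d u w))
                           (irregular : TransmissionIrregular d)
                           (v : Fin (suc m)) (v-min : ∀ u → Tr d v ≤ Tr d u) where

  open Transmission G d isDist

  Tr-v<Tr-neighbour : ∀ y → Edge G v y → Tr d v < Tr d y
  Tr-v<Tr-neighbour y e = ≤∧≢⇒< (v-min y) (irregular v y (edge⇒≢ G e))

  2*count-nearer≤m : ∀ y → Edge G v y → 2 * count (nearer y v) ≤ m
  2*count-nearer≤m y e = ≤-pred (+-cancelˡ-< (Tr d v) _ _ (begin-strict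
    Tr d v + 2 * count (nearer y v)  <⟨ +-monoˡ-< _ (Tr-v<Tr-neighbour y e) ⟩
    Tr d y + 2 * count (nearer y v)  ≤⟨ Tr+2*count-nearer≤ e ⟩
    Tr d v + suc m                   ∎))
    where open ≤-Reasoning

  2*count-nearer≡m⇒Tr≡ : ∀ y → Edge G v y → 2 * count (nearer y v) ≡ m → Tr d y ≡ suc (Tr d v)
  2*count-nearer≡m⇒Tr≡ y e 2c≡m = ≤-antisym Tr-y≤ (Tr-v<Tr-neighbour y e)
    where
      Tr-y≤ : Tr d y ≤ suc (Tr d v)
      Tr-y≤ = +-cancelʳ-≤ m _ _ (subst₂ _≤_ (cong (Tr d y +_) 2c≡m) (+-suc (Tr d v) m)
                                           (Tr+2*count-nearer≤ e))

  NearerCover : List (Fin (suc m)) → Set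
  NearerCover ys = ∀ i → Any (λ y → T (nearer y v (punchIn v i))) ys

  neighbours-cover : NearerCover (neighbours G v)
  neighbours-cover i with geodesic-step (punchInᵢ≢i v i ∘ sym)
  ... | _ , _ , e , w , j<d = lose (∈-neighbours⁺ G e) (walk⇒nearer w j<d)

  ¬NearerCover-by-two : 1 ≤ m → ∀ ys → Unique ys → All (Edge G v) ys → NearerCover ys →
                        length ys < 3 → ⊥
  ¬NearerCover-by-two 1≤m [] _ _ cover _ with cover (fromℕ< 1≤m)
  ... | ()
  ¬NearerCover-by-two 1≤m (a ∷ []) _ (e ∷ []) cover _ =
    <⇒≱ (≤-<-trans m≤c (n<2*n (≤-trans 1≤m m≤c))) (2*count-nearer≤m a e)
    where
      m≤c : m ≤ count (nearer a v)
      m≤c = ≤-trans (count-all (singleton⁻ ∘ cover)) (count-punchIn-≤ (nearer a v) v)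
  ¬NearerCover-by-two _ (a ∷ b ∷ []) ((a≢b ∷ []) ∷ _) (eₐ ∷ e_b ∷ []) cover _ =
    irregular a b a≢b (trans (2*count-nearer≡m⇒Tr≡ a eₐ 2cₐ≡m)
                             (sym (2*count-nearer≡m⇒Tr≡ b e_b 2c_b≡m)))
    where
      cₐ = count (nearer a v)
      c_b = count (nearer b v)

      m≤cₐ+c_b : m ≤ cₐ + c_b
      m≤cₐ+c_b = ≤-trans (count-cover₂ (map₂ singleton⁻ ∘ toSum ∘ cover))
                         (+-mono-≤ (count-punchIn-≤ (nearer a v) v) (count-punchIn-≤ (nearer b v) v))

      2cₐ≡m : 2 * cₐ ≡ m
      2cₐ≡m = ≤+∧2*≤⇒2*≡ cₐ c_b m≤cₐ+c_b (2*count-nearer≤m a eₐ) (2*count-nearer≤m b e_b)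

      2c_b≡m : 2 * c_b ≡ m
      2c_b≡m = ≤+∧2*≤⇒2*≡ c_b cₐ (subst (m ≤_) (+-comm cₐ c_b) m≤cₐ+c_b)
                                 (2*count-nearer≤m b e_b) (2*count-nearer≤m a eₐ)
  ¬NearerCover-by-two _ (_ ∷ _ ∷ _ ∷ _) _ _ _ (s≤s (s≤s (s≤s ())))

  degree≥3 : 1 ≤ m → 3 ≤ degree G v
  degree≥3 1≤m = ≮⇒≥ λ deg<3 →
    ¬NearerCover-by-two 1≤m (neighbours G v) (neighbours-unique G v)
      (All.tabulate (∈-neighbours⁻ G)) neighbours-cover
      (subst (_< 3) (degree≡length-neighbours G v) deg<3)

  component-bound : Acyclic G → (C : Subset m) → IsComponent (deleteVertex G v) C →
                    2 * ∣ C ∣ < suc m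
  component-bound acyclic C ((_ , x₀∈C) , connected , closed)
    with ComponentGeodesics.component⊆nearer G d isDist v closed acyclic connected x₀∈C
  ... | u , e , C⊆nearer = s≤s (≤-trans (*-monoʳ-≤ 2 ∣C∣≤count) (2*count-nearer≤m u e))
    where
      ∣C∣≤count : ∣ C ∣ ≤ count (nearer u v)
      ∣C∣≤count = ≤-trans (∣p∣≤count C C⊆nearer) (count-punchIn-≤ (nearer u v) v)

lemma3 : (m : ℕ) → 1 ≤ m → (T : Graph (suc m)) → IsTree T
       → (d : Fin (suc m) → Fin (suc m) → ℕ) → (∀ u w → IsDistance T u w (d u w))
       → TransmissionIrregular d
       → (v : Fin (suc m)) → (∀ u → Tr d v ≤ Tr d u)
       → 3 ≤ degree T v
         × (∀ (C : Subset m) → IsComponent (deleteVertex T v) C → 2 * ∣ C ∣ < suc m)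
lemma3 m 1≤m T (_ , acyclic) d isDist irregular v v-min =
  degree≥3 1≤m , component-bound acyclic
  where open MinimumTransmission T d isDist irregular v v-min
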